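{- Let $C_n$ be the cycle graph on $n\ge 3$ vertices and let $L$ be its Laplacian matrix. Then \[ \operatorname{per}(L\circ L)\ \le\ \operatorname{per}(L)^2. \]
   Context: The Laplacian of a simple graph is $L=D-A$ (degree matrix minus adjacency matrix). $\operatorname{per}$ denotes the permanent and $\circ$ the Hadamard (entrywise) product. -}

module Defs where

open import Data.Nat as ℕ using (ℕ; zero; suc; _%_)
open import Data.Nat.Properties using (_≟_)
open import Data.Fin using (Fin; toℕ; punchIn)
open import Data.Integer as ℤ using (ℤ; +_; _-_; _*_; _+_)
open import Data.Bool using (Bool; true; false; _∨_; if_then_else_)
open import Relation.Nullary.Decidable using (⌊_⌋)

Matrix : ℕ → Set
Matrix n = Fin n → Fin n → ℤ

∑ : ∀ {n} → (Fin n → ℤ) → ℤ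
∑ {zero}  f = + 0
∑ {suc n} f = f Data.Fin.zero + ∑ (λ i → f (Data.Fin.suc i))

minor : ∀ {n} → Matrix (suc n) → Fin (suc n) → Matrix n
minor A j r c = A (Data.Fin.suc r) (punchIn j c)

-- Permanent: per A = Σ_σ Π_i A i (σ i), computed by (sign-free) Laplace
-- expansion along the first row, which is equal to the Leibniz sum.
per : ∀ {n} → Matrix n → ℤ
per {zero}  A = + 1
per {suc n} A = ∑ (λ j → A Data.Fin.zero j * per (minor A j))

_∘ₕ_ : ∀ {n} → Matrix n → Matrix n → Matrix n
(A ∘ₕ B) i j = A i j * B i j

cycleAdj : (n : ℕ) → Fin n → Fin n → Bool
cycleAdj n i j = ⌊ toℕ j ≟ (suc (toℕ i)) % suc (ℕ.pred n) ⌋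
               ∨ ⌊ toℕ i ≟ (suc (toℕ j)) % suc (ℕ.pred n) ⌋

adjacency : (n : ℕ) → Matrix n
adjacency n i j = if cycleAdj n i j then + 1 else + 0

degree : (n : ℕ) → Fin n → ℤ
degree n i = ∑ (λ j → adjacency n i j)

laplacian : (n : ℕ) → Matrix n
laplacian n i j = (if ⌊ toℕ i ≟ toℕ j ⌋ then degree n i else + 0) - adjacency n i j

private
  open import Relation.Binary.PropositionalEquality using (_≡_; refl)
  test3 : degree 3 Data.Fin.zero ≡ + 2
  test3 = refl
  test4 : degree 4 Data.Fin.zero ≡ + 2
  test4 = refl

module Submission where

open import Defs
open import Data.Nat using (ℕ; _≤_)
open import Data.Integer using (_*_) renaming (_≤_ to _≤ℤ_)

import Data.Integer.Properties as ℤP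
open import Algebra.Properties.Semiring.Sum ℤP.+-*-semiring
  using (sum; sum-cong-≗; sum-init-last; sum-replicate-zero; *-distribˡ-sum; ∑-distrib-+)
open import Data.Bool using (Bool; true; false; if_then_else_; _∨_)
open import Data.Bool.Properties using (if-cong)
open import Data.Fin using (Fin; zero; suc; toℕ; inject₁; fromℕ; punchIn)
open import Data.Fin.Properties using (toℕ-inject₁; toℕ-inject₁-≢; toℕ-fromℕ; toℕ≤pred[n])
open import Data.Integer as ℤ using (ℤ; +_; _+_; _-_; -1ℤ; 1ℤ)
open import Data.Integer.Tactic.RingSolver using (solve-∀)
open import Data.Nat as ℕ using (zero; suc; _≡ᵇ_; _<_; z≤n; s≤s)
open import Data.Nat.DivMod using (_%_; m<n⇒m%n≡m; n%n≡0; m%n<n)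
open import Data.Nat.Properties
  using (_≟_; suc-injective; 0≢1+n; m<n⇒m<1+n; m≤n⇒m<n∨m≡n; <⇒≢; n<1+n; n≤1+n; <-trans;
         ≤-refl; ≤-trans; ≤-reflexive; +-mono-≤; +-monoˡ-≤; *-monoʳ-≤; *-mono-≤; m≤m+n; *-identityʳ)
import Data.Nat.Tactic.RingSolver as ℕ-Solver
open import Data.Product using (Σ; _×_; _,_)
open import Data.Sum using (_⊎_; inj₁; inj₂)
open import Function using (_∘_)
open import Function.Bundles using (mk⇔)
open import Relation.Nullary using (yes; no; contradiction)
open import Relation.Nullary.Decidable using (dec-true; dec-false; isYes≗does; does-⇔)
open import Relation.Binary.PropositionalEquality
open ≡-Reasoning

-- Write n = m + 3 and number the vertices 0, …, k = m + 2.  A weighted cycle (x on the diagonal,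
-- y on the edges) is the tridiagonal band matrix of the path plus the two corner entries of the
-- edge {0, k}.  Changing a corner entry by d changes the permanent by d times the permanent of the
-- complementary block, and those blocks are triangular or tridiagonal again, so
--   per = x K(k) + 2 y² K(k - 1) + 2 yⁿ,
-- where K is the continuant K(j + 2) = x K(j + 1) + y² K(j), the permanent of the j × j band.
-- L is the cycle with (x, y) = (2, -1) and L ∘ L the one with (4, 1).  Their continuants p and q
-- satisfy q ≤ p², hence
--   per (L ∘ L) = 4 q(k) + 2 q(k - 1) + 2 ≤ 4 p(k)² + 2 p(k - 1)² + 2 ≤ (2 p(k) + 2 p(k - 1) - 2)²,
-- and 0 ≤ 2 p(k) + 2 p(k - 1) - 2 ≤ per L = 2 p(k) + 2 p(k - 1) ± 2.

≡ᵇ-true : ∀ {a b} → a ≡ b → (a ≡ᵇ b) ≡ true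
≡ᵇ-true {a} {b} = dec-true (a ≟ b)

≡ᵇ-false : ∀ {a b} → a ≢ b → (a ≡ᵇ b) ≡ false
≡ᵇ-false {a} {b} = dec-false (a ≟ b)

≡ᵇ-sym : ∀ a b → (a ≡ᵇ b) ≡ (b ≡ᵇ a)
≡ᵇ-sym a b = does-⇔ (mk⇔ sym sym) (a ≟ b) (b ≟ a)

∑≡sum : ∀ {n} (f : Fin n → ℤ) → ∑ f ≡ sum f
∑≡sum {zero}  f = refl
∑≡sum {suc n} f = cong (_+_ (f zero)) (∑≡sum (λ i → f (suc i)))

sum-zero : ∀ {n} (f : Fin n → ℤ) → (∀ i → f i ≡ + 0) → sum f ≡ + 0
sum-zero {n} f f≗0 = trans (sum-cong-≗ f≗0) (sum-replicate-zero n)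

indicator : ℕ → ℕ → ℤ
indicator c b = if b ≡ᵇ c then + 1 else + 0

sum-indicator : ∀ {n} c → c < n → sum (λ (j : Fin n) → indicator c (toℕ j)) ≡ + 1
sum-indicator {suc n} zero    _         = cong (_+_ (+ 1)) (sum-replicate-zero n)
sum-indicator {suc n} (suc c) (s≤s c<n) = cong (_+_ (+ 0)) (sum-indicator c c<n)

indicator-∨ : ∀ {b c d} → c ≢ d →
              (if (b ≡ᵇ c) ∨ (b ≡ᵇ d) then + 1 else + 0)
              ≡ (if b ≡ᵇ c then + 1 else + 0) + (if b ≡ᵇ d then + 1 else + 0)
indicator-∨ {b} {c} c≢d with b ≟ c
... | yes refl rewrite ≡ᵇ-true {b} refl | ≡ᵇ-false c≢d = refl
... | no b≢c   rewrite ≡ᵇ-false b≢c = sym (ℤP.+-identityˡ _)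

-- Permanents

per-expand : ∀ {n} (A : Matrix (suc n)) → per A ≡ sum (λ j → A zero j * per (minor A j))
per-expand A = ∑≡sum (λ j → A zero j * per (minor A j))

per-cong : ∀ {n} {A B : Matrix n} → (∀ i j → A i j ≡ B i j) → per A ≡ per B
per-cong {zero}  _   = refl
per-cong {suc n} {A} {B} A≗B = begin
  per A                                    ≡⟨ per-expand A ⟩
  sum (λ j → A zero j * per (minor A j))   ≡⟨ sum-cong-≗ (λ j → cong₂ _*_ (A≗B zero j)
                                                (per-cong (λ r c → A≗B (suc r) (punchIn j c)))) ⟩
  sum (λ j → B zero j * per (minor B j))   ≡⟨ per-expand B ⟨
  per B                                    ∎

per-zero-firstColumn : ∀ {n} (A : Matrix (suc n)) → (∀ i → A i zero ≡ + 0) → per A ≡ + 0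
per-zero-firstColumn {zero}  A col₀ = cong (λ a → a * + 1 + + 0) (col₀ zero)
per-zero-firstColumn {suc n} A col₀ = begin
  per A                                                    ≡⟨ per-expand A ⟩
  A zero zero * per (minor A zero)
    + sum (λ j → A zero (suc j) * per (minor A (suc j)))   ≡⟨ cong₂ _+_ (cong (_* per (minor A zero)) (col₀ zero))
                                                                (sum-zero _ minors-vanish) ⟩
  + 0 * per (minor A zero) + + 0                           ∎
  where
  minors-vanish : ∀ j → A zero (suc j) * per (minor A (suc j)) ≡ + 0
  minors-vanish j = trans (cong (A zero (suc j) *_) (per-zero-firstColumn (minor A (suc j)) (col₀ ∘ suc)))
                          (ℤP.*-zeroʳ (A zero (suc j)))

per-expand-firstColumn : ∀ {n} (A : Matrix (suc n)) → (∀ i → A (suc i) zero ≡ + 0) →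
                         per A ≡ A zero zero * per (minor A zero)
per-expand-firstColumn {zero}  A _     = ℤP.+-identityʳ (A zero zero * + 1)
per-expand-firstColumn {suc n} A below = begin
  per A                                                    ≡⟨ per-expand A ⟩
  A zero zero * per (minor A zero)
    + sum (λ j → A zero (suc j) * per (minor A (suc j)))   ≡⟨ cong (_+_ (A zero zero * per (minor A zero)))
                                                                (sum-zero _ minors-vanish) ⟩
  A zero zero * per (minor A zero) + + 0                   ≡⟨ ℤP.+-identityʳ _ ⟩
  A zero zero * per (minor A zero)                         ∎
  where
  minors-vanish : ∀ j → A zero (suc j) * per (minor A (suc j)) ≡ + 0
  minors-vanish j = trans (cong (A zero (suc j) *_) (per-zero-firstColumn (minor A (suc j)) below))
                          (ℤP.*-zeroʳ (A zero (suc j)))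

per-expand-firstRow : ∀ {n} (A : Matrix (suc n)) → (∀ j → A zero (suc j) ≡ + 0) →
                      per A ≡ A zero zero * per (minor A zero)
per-expand-firstRow A right = begin
  per A                                                    ≡⟨ per-expand A ⟩
  A zero zero * per (minor A zero)
    + sum (λ j → A zero (suc j) * per (minor A (suc j)))   ≡⟨ cong (_+_ (A zero zero * per (minor A zero)))
                                                                (sum-zero _ λ j → cong (_* per (minor A (suc j))) (right j)) ⟩
  A zero zero * per (minor A zero) + + 0                   ≡⟨ ℤP.+-identityʳ _ ⟩
  A zero zero * per (minor A zero)                         ∎

punchIn-fromℕ : ∀ {n} (j : Fin n) → punchIn (fromℕ n) j ≡ inject₁ j
punchIn-fromℕ zero    = refl
punchIn-fromℕ (suc j) = cong suc (punchIn-fromℕ j)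

per-update-topRight : ∀ {n} (A B : Matrix (suc n)) (d : ℤ) →
                      (∀ i j → A (suc i) j ≡ B (suc i) j) →
                      (∀ j → A zero (inject₁ j) ≡ B zero (inject₁ j)) →
                      A zero (fromℕ n) ≡ B zero (fromℕ n) + d →
                      per A ≡ per B + d * per (λ i j → A (suc i) (inject₁ j))
per-update-topRight {n} A B d rows row₀ corner = begin
  per A                                                        ≡⟨ per-expand A ⟩
  sum termA                                                    ≡⟨ sum-init-last termA ⟩
  sum (termA ∘ inject₁) + termA (fromℕ n)                      ≡⟨ cong₂ _+_ (sum-cong-≗ λ j → cong₂ _*_ (row₀ j) (minors (inject₁ j)))
                                                                          lastTerm ⟩
  sum (termB ∘ inject₁) + (termB (fromℕ n) + d * P)            ≡⟨ ℤP.+-assoc (sum (termB ∘ inject₁)) (termB (fromℕ n)) (d * P) ⟨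
  sum (termB ∘ inject₁) + termB (fromℕ n) + d * P              ≡⟨ cong (_+ d * P) (sum-init-last termB) ⟨
  sum termB + d * P                                            ≡⟨ cong (_+ d * P) (per-expand B) ⟨
  per B + d * P                                                ∎
  where
  P : ℤ
  P = per (λ i j → A (suc i) (inject₁ j))
  termA termB : Fin (suc n) → ℤ
  termA j = A zero j * per (minor A j)
  termB j = B zero j * per (minor B j)
  minors : ∀ j → per (minor A j) ≡ per (minor B j)
  minors j = per-cong (λ i c → rows i (punchIn j c))
  lastMinor : per (minor A (fromℕ n)) ≡ P
  lastMinor = per-cong λ i j → cong (A (suc i)) (punchIn-fromℕ j)
  lastTerm : termA (fromℕ n) ≡ termB (fromℕ n) + d * P
  lastTerm = begin
    A zero (fromℕ n) * per (minor A (fromℕ n))           ≡⟨ cong₂ _*_ corner lastMinor ⟩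
    (B zero (fromℕ n) + d) * P                           ≡⟨ ℤP.*-distribʳ-+ P (B zero (fromℕ n)) d ⟩
    B zero (fromℕ n) * P + d * P                         ≡⟨ cong (λ p → B zero (fromℕ n) * p + d * P)
                                                              (trans (sym (minors (fromℕ n))) lastMinor) ⟨
    B zero (fromℕ n) * per (minor B (fromℕ n)) + d * P   ∎

per-update-bottomLeft : ∀ {n} (A B : Matrix (suc n)) (d : ℤ) →
                        (∀ i j → A i (suc j) ≡ B i (suc j)) →
                        (∀ i → A (inject₁ i) zero ≡ B (inject₁ i) zero) →
                        A (fromℕ n) zero ≡ B (fromℕ n) zero + d →
                        per A ≡ per B + d * per (λ i j → A (inject₁ i) (suc j))
per-update-bottomLeft {zero} A B d _ _ corner =
  trans (cong (λ a → a * + 1 + + 0) corner) (1×1 (B zero zero) d)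
  where
  1×1 : ∀ b d → (b + d) * + 1 + + 0 ≡ b * + 1 + + 0 + d * + 1
  1×1 = solve-∀
per-update-bottomLeft {suc n} A B d cols col₀ corner = begin
  per A                                                   ≡⟨ per-expand A ⟩
  A zero zero * per (minor A zero) + sum termA            ≡⟨ cong₂ _+_ (cong₂ _*_ (col₀ zero) (per-cong λ i j → cols (suc i) j))
                                                                       (sum-cong-≗ split) ⟩
  B zero zero * per (minor B zero)
    + sum (λ j → termB j + d * termC j)                   ≡⟨ cong (_+_ (B zero zero * per (minor B zero)))
                                                               (trans (∑-distrib-+ termB (λ j → d * termC j))
                                                                      (cong (_+_ (sum termB)) (sym (*-distribˡ-sum d termC)))) ⟩
  B zero zero * per (minor B zero)
    + (sum termB + d * sum termC)                         ≡⟨ ℤP.+-assoc (B zero zero * per (minor B zero)) (sum termB) (d * sum termC) ⟨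
  B zero zero * per (minor B zero) + sum termB
    + d * sum termC                                       ≡⟨ cong₂ (λ p q → p + d * q) (per-expand B) (per-expand C) ⟨
  per B + d * per C                                       ∎
  where
  C : Matrix (suc n)
  C i j = A (inject₁ i) (suc j)
  termA termB termC : Fin (suc n) → ℤ
  termA j = A zero (suc j) * per (minor A (suc j))
  termB j = B zero (suc j) * per (minor B (suc j))
  termC j = C zero j * per (minor C j)
  regroup : ∀ a d pB pC → a * (pB + d * pC) ≡ a * pB + d * (a * pC)
  regroup = solve-∀
  split : ∀ j → termA j ≡ termB j + d * termC j
  split j = begin
    A zero (suc j) * per (minor A (suc j))                           ≡⟨ cong (A zero (suc j) *_)
                                                                          (per-update-bottomLeft (minor A (suc j)) (minor B (suc j)) d
                                                                            (λ i c → cols (suc i) (punchIn j c)) (col₀ ∘ suc) corner) ⟩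
    A zero (suc j) * (per (minor B (suc j)) + d * per (minor C j))   ≡⟨ regroup (A zero (suc j)) d (per (minor B (suc j))) (per (minor C j)) ⟩
    A zero (suc j) * per (minor B (suc j)) + d * termC j             ≡⟨ cong (λ a → a * per (minor B (suc j)) + d * termC j) (cols zero j) ⟩
    termB j + d * termC j                                            ∎

-- Band matrices

leading : ∀ {n} → (ℕ → ℕ → ℤ) → Matrix n
leading F i j = F (toℕ i) (toℕ j)

module Band (x y : ℤ) where

  -- Written with _≡ᵇ_ rather than ⌊ _ ≟ _ ⌋ because suc a ≡ᵇ suc b reduces to a ≡ᵇ b, which makes
  -- the minors of the band matrices below definitionally band matrices again.
  band : ℕ → ℕ → ℤ
  band a b = if a ≡ᵇ b then x else if (b ≡ᵇ suc a) ∨ (a ≡ᵇ suc b) then y else + 0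

  continuant : ℕ → ℤ
  continuant zero          = + 1
  continuant (suc zero)    = x
  continuant (suc (suc n)) = x * continuant (suc n) + y * y * continuant n

  per-band : ∀ n → per (leading {n} band) ≡ continuant n
  per-band zero          = refl
  per-band (suc zero)    = trans (ℤP.+-identityʳ (x * + 1)) (ℤP.*-identityʳ x)
  per-band (suc (suc n)) = begin
    per (leading {suc (suc n)} band)                          ≡⟨ per-expand (leading {suc (suc n)} band) ⟩
    x * per (leading {suc n} band) + (y * per M + sum {n} (λ _ → + 0))
                                                              ≡⟨ cong₂ (λ p q → x * p + (y * q + sum {n} (λ _ → + 0)))
                                                                       (per-band (suc n)) perM ⟩
    x * continuant (suc n) + (y * (y * continuant n) + sum {n} (λ _ → + 0))
                                                              ≡⟨ cong (λ q → x * continuant (suc n) + (y * (y * continuant n) + q))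
                                                                      (sum-replicate-zero n) ⟩
    x * continuant (suc n) + (y * (y * continuant n) + + 0)   ≡⟨ regroup x y (continuant (suc n)) (continuant n) ⟩
    continuant (suc (suc n))                                  ∎
    where
    M : Matrix (suc n)
    M = minor (leading band) (suc zero)
    perM : per M ≡ y * continuant n
    perM = trans (per-expand-firstColumn M λ _ → refl) (cong (y *_) (per-band n))
    regroup : ∀ x y p q → x * p + (y * (y * q) + + 0) ≡ x * p + y * y * q
    regroup = solve-∀

  per-band-rowShift : ∀ n → per (leading {n} (λ a b → band (suc a) b)) ≡ y ℤ.^ n
  per-band-rowShift zero    = refl
  per-band-rowShift (suc n) = trans (per-expand-firstColumn (leading {suc n} (λ a b → band (suc a) b)) λ _ → refl)
                                    (cong (y *_) (per-band-rowShift n))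

  per-band-columnShift : ∀ n → per (leading {n} (λ a b → band a (suc b))) ≡ y ℤ.^ n
  per-band-columnShift zero    = refl
  per-band-columnShift (suc n) = trans (per-expand-firstRow (leading {suc n} (λ a b → band a (suc b))) λ _ → refl)
                                       (cong (y *_) (per-band-columnShift n))

  topRight : ℕ → ℕ → ℕ → ℤ
  topRight k zero    b = if b ≡ᵇ k then y else + 0
  topRight k (suc a) b = + 0

  bottomLeft : ℕ → ℕ → ℕ → ℤ
  bottomLeft k a zero    = if a ≡ᵇ k then y else + 0
  bottomLeft k a (suc b) = + 0

  cycleBand : ℕ → ℕ → ℕ → ℤ
  cycleBand k a b = band a b + topRight k a b + bottomLeft k a b

  topRight-on : ∀ {k b} → b ≡ k → topRight k zero b ≡ y
  topRight-on b≡k = cong (if_then y else + 0) (≡ᵇ-true b≡k)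

  topRight-off : ∀ {k b} a → b ≢ k → topRight k a b ≡ + 0
  topRight-off zero    b≢k = cong (if_then y else + 0) (≡ᵇ-false b≢k)
  topRight-off (suc a) _   = refl

  bottomLeft-on : ∀ {k a} → a ≡ k → bottomLeft k a zero ≡ y
  bottomLeft-on a≡k = cong (if_then y else + 0) (≡ᵇ-true a≡k)

  bottomLeft-off : ∀ {k a} b → a ≢ k → bottomLeft k a b ≡ + 0
  bottomLeft-off zero    a≢k = cong (if_then y else + 0) (≡ᵇ-false a≢k)
  bottomLeft-off (suc b) _   = refl

  per-band+topRight : ∀ k → per (leading {suc k} (λ a b → band a b + topRight k a b)) ≡ continuant (suc k) + y * y ℤ.^ k
  per-band+topRight k = begin
    per A                                                    ≡⟨ per-update-topRight A (leading {suc k} band) y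
                                                                  (λ _ _ → ℤP.+-identityʳ _) row₀ corner ⟩
    per (leading {suc k} band) + y * per (λ i j → A (suc i) (inject₁ j))
                                                             ≡⟨ cong₂ (λ p q → p + y * q) (per-band (suc k))
                                                                      (trans (per-cong rowShift) (per-band-rowShift k)) ⟩
    continuant (suc k) + y * y ℤ.^ k                         ∎
    where
    A : Matrix (suc k)
    A = leading (λ a b → band a b + topRight k a b)
    row₀ : ∀ j → A zero (inject₁ j) ≡ band 0 (toℕ (inject₁ j))
    row₀ j = trans (cong (_+_ (band 0 (toℕ (inject₁ j)))) (topRight-off 0 (toℕ-inject₁-≢ j ∘ sym)))
                   (ℤP.+-identityʳ _)
    corner : A zero (fromℕ k) ≡ band 0 (toℕ (fromℕ k)) + y
    corner = cong (_+_ (band 0 (toℕ (fromℕ k)))) (topRight-on (toℕ-fromℕ k))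
    rowShift : ∀ i j → A (suc i) (inject₁ j) ≡ band (suc (toℕ i)) (toℕ j)
    rowShift i j = trans (ℤP.+-identityʳ _) (cong (band (suc (toℕ i))) (toℕ-inject₁ j))

  per-columnShift+topRight : ∀ k → per (leading {suc k} (λ a b → band a (suc b) + topRight (suc k) a (suc b)))
                                   ≡ y ℤ.^ suc k + y * continuant k
  per-columnShift+topRight k = begin
    per A                                                    ≡⟨ per-update-topRight A (leading {suc k} (λ a b → band a (suc b))) y
                                                                  (λ _ _ → ℤP.+-identityʳ _) row₀ corner ⟩
    per (leading {suc k} (λ a b → band a (suc b))) + y * per (λ i j → A (suc i) (inject₁ j))
                                                             ≡⟨ cong₂ (λ p q → p + y * q) (per-band-columnShift (suc k))
                                                                      (trans (per-cong block) (per-band k)) ⟩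
    y ℤ.^ suc k + y * continuant k                           ∎
    where
    A : Matrix (suc k)
    A = leading (λ a b → band a (suc b) + topRight (suc k) a (suc b))
    row₀ : ∀ j → A zero (inject₁ j) ≡ band 0 (suc (toℕ (inject₁ j)))
    row₀ j = trans (cong (_+_ (band 0 (suc (toℕ (inject₁ j))))) (topRight-off 0 (toℕ-inject₁-≢ j ∘ sym ∘ suc-injective)))
                   (ℤP.+-identityʳ _)
    corner : A zero (fromℕ k) ≡ band 0 (suc (toℕ (fromℕ k))) + y
    corner = cong (_+_ (band 0 (suc (toℕ (fromℕ k))))) (topRight-on (cong suc (toℕ-fromℕ k)))
    block : ∀ i j → A (suc i) (inject₁ j) ≡ band (toℕ i) (toℕ j)
    block i j = trans (ℤP.+-identityʳ _) (cong (band (toℕ i)) (toℕ-inject₁ j))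

  per-cycleBand : ∀ k → per (leading {2 ℕ.+ k} (cycleBand (suc k)))
                        ≡ x * continuant (suc k) + + 2 * (y * y * continuant k) + + 2 * y ℤ.^ (2 ℕ.+ k)
  per-cycleBand k = begin
    per C                                                    ≡⟨ per-update-bottomLeft C P y (λ _ _ → ℤP.+-identityʳ _) col₀ corner ⟩
    per P + y * per (λ i j → C (inject₁ i) (suc j))          ≡⟨ cong₂ (λ p q → p + y * q) (per-band+topRight (suc k))
                                                                      (trans (per-cong block) (per-columnShift+topRight k)) ⟩
    continuant (2 ℕ.+ k) + y * y ℤ.^ suc k + y * (y ℤ.^ suc k + y * continuant k)
                                                             ≡⟨ regroup x y (continuant (suc k)) (continuant k) (y ℤ.^ suc k) ⟩
    x * continuant (suc k) + + 2 * (y * y * continuant k) + + 2 * y ℤ.^ (2 ℕ.+ k)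
                                                             ∎
    where
    C P : Matrix (2 ℕ.+ k)
    C = leading (cycleBand (suc k))
    P = leading (λ a b → band a b + topRight (suc k) a b)
    col₀ : ∀ i → C (inject₁ i) zero ≡ P (inject₁ i) zero
    col₀ i = trans (cong (_+_ (P (inject₁ i) zero)) (bottomLeft-off 0 (toℕ-inject₁-≢ i ∘ sym))) (ℤP.+-identityʳ _)
    corner : C (fromℕ (suc k)) zero ≡ P (fromℕ (suc k)) zero + y
    corner = cong (_+_ (P (fromℕ (suc k)) zero)) (bottomLeft-on (toℕ-fromℕ (suc k)))
    block : ∀ i j → C (inject₁ i) (suc j) ≡ band (toℕ i) (suc (toℕ j)) + topRight (suc k) (toℕ i) (suc (toℕ j))
    block i j = trans (ℤP.+-identityʳ _)
                      (cong (λ a → band a (suc (toℕ j)) + topRight (suc k) a (suc (toℕ j))) (toℕ-inject₁ i))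
    regroup : ∀ x y c₁ c₀ Y → x * c₁ + y * y * c₀ + y * Y + y * (Y + y * c₀) ≡ x * c₁ + + 2 * (y * y * c₀) + + 2 * (y * Y)
    regroup = solve-∀

  cycleWeight : ℕ → ℕ → ℕ → ℤ
  cycleWeight k a b = if a ≡ᵇ b then x else if (b ≡ᵇ suc a % suc k) ∨ (a ≡ᵇ suc b % suc k) then y else + 0

  cycleWeight-via : ∀ {k a b na nb} → suc a % suc k ≡ na → suc b % suc k ≡ nb →
                    cycleWeight k a b ≡ (if a ≡ᵇ b then x else if (b ≡ᵇ na) ∨ (a ≡ᵇ nb) then y else + 0)
  cycleWeight-via {a = a} {b} = cong₂ (λ na nb → if a ≡ᵇ b then x else if (b ≡ᵇ na) ∨ (a ≡ᵇ nb) then y else + 0)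

  cycleBand-inner : ∀ {k a b} → a ≢ k → b ≢ k → cycleBand k a b ≡ band a b
  cycleBand-inner {k} {a} {b} a≢k b≢k = begin
    band a b + topRight k a b + bottomLeft k a b   ≡⟨ cong₂ (λ t l → band a b + t + l) (topRight-off a b≢k) (bottomLeft-off b a≢k) ⟩
    band a b + + 0 + + 0                           ≡⟨ trans (ℤP.+-identityʳ _) (ℤP.+-identityʳ _) ⟩
    band a b                                       ∎

  module _ (m : ℕ) where

    private
      k : ℕ
      k = 2 ℕ.+ m

    cycleBand-lastRow : ∀ {b} → b < k →
                        (if k ≡ᵇ b then x else if (b ≡ᵇ 0) ∨ (k ≡ᵇ suc b) then y else + 0) ≡ cycleBand k k b
    cycleBand-lastRow {zero}  _   = sym (trans (ℤP.+-identityˡ _) (bottomLeft-on {k} refl))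
    cycleBand-lastRow {suc b} b<k = sym (begin
      band k (suc b) + + 0 + + 0                                          ≡⟨ trans (ℤP.+-identityʳ _) (ℤP.+-identityʳ _) ⟩
      (if suc m ≡ᵇ b then x else if (b ≡ᵇ k) ∨ (m ≡ᵇ b) then y else + 0)
        ≡⟨ cong (λ c → if suc m ≡ᵇ b then x else if c ∨ (m ≡ᵇ b) then y else + 0) (≡ᵇ-false (<⇒≢ (<-trans (n<1+n b) b<k))) ⟩
      (if suc m ≡ᵇ b then x else if m ≡ᵇ b then y else + 0)               ∎)

    cycleBand-lastColumn : ∀ {a} → a < k →
                           (if a ≡ᵇ k then x else if (k ≡ᵇ suc a) ∨ (a ≡ᵇ 0) then y else + 0) ≡ cycleBand k a k
    cycleBand-lastColumn {zero}  _   = sym (trans (ℤP.+-identityʳ _) (trans (ℤP.+-identityˡ _) (topRight-on {k} refl)))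
    cycleBand-lastColumn {suc a} a<k = sym (begin
      band (suc a) k + + 0 + + 0                                          ≡⟨ trans (ℤP.+-identityʳ _) (ℤP.+-identityʳ _) ⟩
      (if a ≡ᵇ suc m then x else if (m ≡ᵇ a) ∨ (a ≡ᵇ k) then y else + 0)
        ≡⟨ cong (λ c → if a ≡ᵇ suc m then x else if (m ≡ᵇ a) ∨ c then y else + 0) (≡ᵇ-false (<⇒≢ (<-trans (n<1+n a) a<k))) ⟩
      (if a ≡ᵇ suc m then x else if (m ≡ᵇ a) ∨ false then y else + 0)     ∎)

    cycleWeight≡cycleBand : ∀ {a b} → a ≤ k → b ≤ k → cycleWeight k a b ≡ cycleBand k a b
    cycleWeight≡cycleBand {a} {b} a≤k b≤k with m≤n⇒m<n∨m≡n a≤k | m≤n⇒m<n∨m≡n b≤k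
    ... | inj₁ a<k  | inj₁ b<k  = trans (cycleWeight-via {k} {a} {b} (m<n⇒m%n≡m (s≤s a<k)) (m<n⇒m%n≡m (s≤s b<k)))
                                        (sym (cycleBand-inner (<⇒≢ a<k) (<⇒≢ b<k)))
    ... | inj₂ refl | inj₁ b<k  = trans (cycleWeight-via {k} {k} {b} (n%n≡0 (suc k)) (m<n⇒m%n≡m (s≤s b<k)))
                                        (cycleBand-lastRow b<k)
    ... | inj₁ a<k  | inj₂ refl = trans (cycleWeight-via {k} {a} {k} (m<n⇒m%n≡m (s≤s a<k)) (n%n≡0 (suc k)))
                                        (cycleBand-lastColumn a<k)
    ... | inj₂ refl | inj₂ refl = trans (if-cong (≡ᵇ-true {k} refl))
                                        (sym (trans (ℤP.+-identityʳ _) (trans (ℤP.+-identityʳ _) (if-cong (≡ᵇ-true {m} refl)))))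

    per-cycleWeight : per (λ (i j : Fin (3 ℕ.+ m)) → cycleWeight k (toℕ i) (toℕ j))
                      ≡ x * continuant (suc (suc m)) + + 2 * (y * y * continuant (suc m)) + + 2 * y ℤ.^ (3 ℕ.+ m)
    per-cycleWeight = trans (per-cong λ i j → cycleWeight≡cycleBand (toℕ≤pred[n] i) (toℕ≤pred[n] j)) (per-cycleBand (suc m))

cycleWeight-square : ∀ x y k a b → Band.cycleWeight x y k a b * Band.cycleWeight x y k a b
                                   ≡ Band.cycleWeight (x * x) (y * y) k a b
cycleWeight-square x y k a b = if-square (a ≡ᵇ b) ((b ≡ᵇ suc a % suc k) ∨ (a ≡ᵇ suc b % suc k))
  where
  if-square : ∀ p q → (if p then x else if q then y else + 0) * (if p then x else if q then y else + 0)
                      ≡ (if p then x * x else if q then y * y else + 0)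
  if-square true  _     = refl
  if-square false true  = refl
  if-square false false = refl

-- Arithmetic of the continuants

continuantℕ : ℕ → ℕ → ℕ → ℕ
continuantℕ x s zero          = 1
continuantℕ x s (suc zero)    = x
continuantℕ x s (suc (suc n)) = x ℕ.* continuantℕ x s (suc n) ℕ.+ s ℕ.* continuantℕ x s n

continuant≡continuantℕ : ∀ x {y} s → y * y ≡ + s → ∀ n → Band.continuant (+ x) y n ≡ + continuantℕ x s n
continuant≡continuantℕ x     s y²≡s zero          = refl
continuant≡continuantℕ x     s y²≡s (suc zero)    = refl
continuant≡continuantℕ x {y} s y²≡s (suc (suc n)) = begin
  + x * Band.continuant (+ x) y (suc n) + y * y * Band.continuant (+ x) y n
                                                  ≡⟨ cong₂ (λ p q → + x * p + q) (continuant≡continuantℕ x s y²≡s (suc n))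
                                                           (cong₂ _*_ y²≡s (continuant≡continuantℕ x s y²≡s n)) ⟩
  + x * + K₁ + + s * + K₀                         ≡⟨ cong₂ _+_ (ℤP.pos-* x K₁) (ℤP.pos-* s K₀) ⟨
  + (x ℕ.* K₁) + + (s ℕ.* K₀)                     ≡⟨ ℤP.pos-+ (x ℕ.* K₁) (s ℕ.* K₀) ⟨
  + (x ℕ.* K₁ ℕ.+ s ℕ.* K₀)                       ∎
  where
  K₁ K₀ : ℕ
  K₁ = continuantℕ x s (suc n)
  K₀ = continuantℕ x s n

continuantℕ-squares : ∀ x s n → continuantℕ (x ℕ.* x) (s ℕ.* s) n ≤ continuantℕ x s n ℕ.* continuantℕ x s n
continuantℕ-squares x s zero          = ≤-refl
continuantℕ-squares x s (suc zero)    = ≤-refl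
continuantℕ-squares x s (suc (suc n)) =
  ≤-trans (+-mono-≤ (*-monoʳ-≤ (x ℕ.* x) (continuantℕ-squares x s (suc n))) (*-monoʳ-≤ (s ℕ.* s) (continuantℕ-squares x s n)))
          (≤-trans (m≤m+n _ (2 ℕ.* (x ℕ.* K₁) ℕ.* (s ℕ.* K₀))) (≤-reflexive (square-expand x s K₁ K₀)))
  where
  K₁ K₀ : ℕ
  K₁ = continuantℕ x s (suc n)
  K₀ = continuantℕ x s n
  square-expand : ∀ x s K₁ K₀ →
                  x ℕ.* x ℕ.* (K₁ ℕ.* K₁) ℕ.+ s ℕ.* s ℕ.* (K₀ ℕ.* K₀) ℕ.+ 2 ℕ.* (x ℕ.* K₁) ℕ.* (s ℕ.* K₀)
                  ≡ (x ℕ.* K₁ ℕ.+ s ℕ.* K₀) ℕ.* (x ℕ.* K₁ ℕ.+ s ℕ.* K₀)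
  square-expand = ℕ-Solver.solve-∀

continuantℕ-≥ : ∀ {x} s n → 1 ≤ x → x ≤ continuantℕ x s (suc n)
continuantℕ-≥     s zero    _   = ≤-refl
continuantℕ-≥ {x} s (suc n) 1≤x =
  ≤-trans (≤-reflexive (sym (*-identityʳ x)))
          (≤-trans (*-monoʳ-≤ x (≤-trans 1≤x (continuantℕ-≥ s n 1≤x))) (m≤m+n _ _))

-1^n≡±1 : ∀ n → -1ℤ ℤ.^ n ≡ + 1 ⊎ -1ℤ ℤ.^ n ≡ -1ℤ
-1^n≡±1 zero    = inj₁ refl
-1^n≡±1 (suc n) with -1^n≡±1 n
... | inj₁ even = inj₂ (cong (-1ℤ *_) even)
... | inj₂ odd  = inj₁ (cong (-1ℤ *_) odd)

pos-linear : ∀ p a q b r → + (p ℕ.* a ℕ.+ q ℕ.* b ℕ.+ r) ≡ + p * + a + + q * + b + + r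
pos-linear p a q b r = trans (ℤP.pos-+ (p ℕ.* a ℕ.+ q ℕ.* b) r)
                             (cong (_+ + r) (trans (ℤP.pos-+ (p ℕ.* a) (q ℕ.* b)) (cong₂ _+_ (ℤP.pos-* p a) (ℤP.pos-* q b))))

cycle-permanent-inequality : ∀ {a b c₂ c₁ : ℕ} {ε : ℤ} →
                             c₂ ≤ a ℕ.* a → c₁ ≤ b ℕ.* b → 1 ≤ a → 2 ≤ b → ε ≡ + 1 ⊎ ε ≡ -1ℤ →
                             + (4 ℕ.* c₂ ℕ.+ 2 ℕ.* c₁ ℕ.+ 2)
                             ≤ℤ (+ 2 * + a + + 2 * + b + + 2 * ε) * (+ 2 * + a + + 2 * + b + + 2 * ε)
cycle-permanent-inequality {suc u} {b} {c₂} {c₁} {ε} c₂≤a² c₁≤b² _ 2≤b ε≡±1 with value ε≡±1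
  where
  value : ε ≡ + 1 ⊎ ε ≡ -1ℤ → Σ ℕ λ B → 2 ℕ.* u ℕ.+ 2 ℕ.* b ≤ B × + 2 * + suc u + + 2 * + b + + 2 * ε ≡ + B
  value (inj₁ refl) = 2 ℕ.* suc u ℕ.+ 2 ℕ.* b ℕ.+ 2
                    , ≤-trans (+-monoˡ-≤ (2 ℕ.* b) (*-monoʳ-≤ 2 (n≤1+n u))) (m≤m+n _ 2)
                    , sym (pos-linear 2 (suc u) 2 b 2)
  value (inj₂ refl) = 2 ℕ.* u ℕ.+ 2 ℕ.* b ℕ.+ 0
                    , m≤m+n _ 0
                    , trans (lower-by-two (+ u) (+ b)) (sym (pos-linear 2 u 2 b 0))
    where lower-by-two : ∀ U B → + 2 * (+ 1 + U) + + 2 * B + + 2 * -1ℤ ≡ + 2 * U + + 2 * B + + 0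
          lower-by-two = solve-∀
... | B , 2u+2b≤B , P≡B = subst (λ P → + _ ≤ℤ P * P) (sym P≡B)
                                (subst (_ ≤ℤ_) (ℤP.pos-* B B) (ℤ.+≤+ (≤-trans bound (*-mono-≤ 2u+2b≤B 2u+2b≤B))))
  where
  expand : ∀ u v → 4 ℕ.* ((1 ℕ.+ u) ℕ.* (1 ℕ.+ u)) ℕ.+ 2 ℕ.* ((2 ℕ.+ v) ℕ.* (2 ℕ.+ v)) ℕ.+ 2
                   ℕ.+ (2 ℕ.+ 8 ℕ.* u ℕ.+ 8 ℕ.* v ℕ.+ 8 ℕ.* u ℕ.* v ℕ.+ 2 ℕ.* v ℕ.* v)
                   ≡ (2 ℕ.* u ℕ.+ 2 ℕ.* (2 ℕ.+ v)) ℕ.* (2 ℕ.* u ℕ.+ 2 ℕ.* (2 ℕ.+ v))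
  expand = ℕ-Solver.solve-∀
  squares-bound : ∀ {b} → 2 ≤ b → 4 ℕ.* (suc u ℕ.* suc u) ℕ.+ 2 ℕ.* (b ℕ.* b) ℕ.+ 2
                                  ≤ (2 ℕ.* u ℕ.+ 2 ℕ.* b) ℕ.* (2 ℕ.* u ℕ.+ 2 ℕ.* b)
  squares-bound {suc (suc v)} _         = ≤-trans (m≤m+n _ _) (≤-reflexive (expand u v))
  squares-bound {suc zero}    (s≤s ())
  bound : 4 ℕ.* c₂ ℕ.+ 2 ℕ.* c₁ ℕ.+ 2 ≤ (2 ℕ.* u ℕ.+ 2 ℕ.* b) ℕ.* (2 ℕ.* u ℕ.+ 2 ℕ.* b)
  bound = ≤-trans (+-monoˡ-≤ 2 (+-mono-≤ (*-monoʳ-≤ 4 c₂≤a²) (*-monoʳ-≤ 2 c₁≤b²))) (squares-bound 2≤b)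

-- The cycle graph C (m + 3)

module CycleGraph (m : ℕ) where

  k : ℕ
  k = 2 ℕ.+ m

  next : ℕ → ℕ
  next a = suc a % suc k

  prev : ℕ → ℕ
  prev zero    = k
  prev (suc a) = a

  next-inner : ∀ {a} → a < k → next a ≡ suc a
  next-inner a<k = m<n⇒m%n≡m (s≤s a<k)

  next-last : next k ≡ 0
  next-last = n%n≡0 (suc k)

  next< : ∀ a → next a < suc k
  next< a = m%n<n (suc a) (suc k)

  prev< : ∀ {a} → a ≤ k → prev a < suc k
  prev< {zero}  _   = n<1+n k
  prev< {suc a} a<k = m<n⇒m<1+n a<k

  next≢id : ∀ {a} → a ≤ k → next a ≢ a
  next≢id a≤k with m≤n⇒m<n∨m≡n a≤k
  ... | inj₁ a<k  = λ eq → <⇒≢ (n<1+n _) (sym (trans (sym (next-inner a<k)) eq))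
  ... | inj₂ refl = λ eq → 0≢1+n (trans (sym next-last) eq)

  next≢prev : ∀ {a} → a ≤ k → next a ≢ prev a
  next≢prev {a} a≤k with m≤n⇒m<n∨m≡n a≤k
  next≢prev {zero}  _ | inj₁ 0<k  = λ eq → 0≢1+n (suc-injective (trans (sym (next-inner 0<k)) eq))
  next≢prev {suc a} _ | inj₁ a<k  = λ eq → <⇒≢ (<-trans (n<1+n a) (n<1+n (suc a))) (sym (trans (sym (next-inner a<k)) eq))
  next≢prev         _ | inj₂ refl = λ eq → 0≢1+n (trans (sym next-last) eq)

  ≡ᵇ-next-prev : ∀ {a b} → a ≤ k → b ≤ k → (a ≡ᵇ next b) ≡ (b ≡ᵇ prev a)
  ≡ᵇ-next-prev {a} {b} a≤k b≤k with m≤n⇒m<n∨m≡n b≤k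
  ≡ᵇ-next-prev {zero}  {b} _   _ | inj₁ b<k  = trans (cong (0 ≡ᵇ_) (next-inner b<k)) (sym (≡ᵇ-false (<⇒≢ b<k)))
  ≡ᵇ-next-prev {suc a} {b} _   _ | inj₁ b<k  = trans (cong (suc a ≡ᵇ_) (next-inner b<k)) (≡ᵇ-sym a b)
  ≡ᵇ-next-prev {zero}      _   _ | inj₂ refl = trans (cong (0 ≡ᵇ_) next-last) (sym (≡ᵇ-true {k} refl))
  ≡ᵇ-next-prev {suc a}     a<k _ | inj₂ refl = trans (cong (suc a ≡ᵇ_) next-last) (sym (≡ᵇ-false (<⇒≢ a<k ∘ sym)))

  adjacency-cycle : ∀ (i j : Fin (suc k)) →
                    adjacency (suc k) i j ≡ indicator (next (toℕ i)) (toℕ j) + indicator (prev (toℕ i)) (toℕ j)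
  adjacency-cycle i j = begin
    adjacency (suc k) i j                                 ≡⟨ cong (if_then + 1 else + 0)
                                                               (cong₂ _∨_ (isYes≗does (b ≟ next a)) (isYes≗does (a ≟ next b))) ⟩
    (if (b ≡ᵇ next a) ∨ (a ≡ᵇ next b) then + 1 else + 0)   ≡⟨ cong (λ c → if (b ≡ᵇ next a) ∨ c then + 1 else + 0)
                                                               (≡ᵇ-next-prev (toℕ≤pred[n] i) (toℕ≤pred[n] j)) ⟩
    (if (b ≡ᵇ next a) ∨ (b ≡ᵇ prev a) then + 1 else + 0)   ≡⟨ indicator-∨ {b} (next≢prev (toℕ≤pred[n] i)) ⟩
    indicator (next a) b + indicator (prev a) b           ∎
    where
    a b : ℕ
    a = toℕ i
    b = toℕ j

  degree-cycle : ∀ i → degree (suc k) i ≡ + 2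
  degree-cycle i = begin
    degree (suc k) i                                              ≡⟨ ∑≡sum (adjacency (suc k) i) ⟩
    sum {suc k} (adjacency (suc k) i)                             ≡⟨ sum-cong-≗ (adjacency-cycle i) ⟩
    sum {suc k} (λ j → indicator (next a) (toℕ j) + indicator (prev a) (toℕ j))
                                                                  ≡⟨ ∑-distrib-+ {suc k} (λ j → indicator (next a) (toℕ j))
                                                                                         (λ j → indicator (prev a) (toℕ j)) ⟩
    sum {suc k} (λ j → indicator (next a) (toℕ j)) + sum {suc k} (λ j → indicator (prev a) (toℕ j))
                                                                  ≡⟨ cong₂ _+_ (sum-indicator (next a) (next< a))
                                                                               (sum-indicator (prev a) (prev< (toℕ≤pred[n] i))) ⟩
    + 2                                                           ∎
    where
    a : ℕ
    a = toℕ i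

  no-loop : ∀ {a b} → a ≤ k → (a ≡ᵇ b) ≡ true → ((b ≡ᵇ next a) ∨ (a ≡ᵇ next b)) ≡ false
  no-loop {a} {b} a≤k a≡ᵇb with a ≟ b
  ... | yes refl rewrite ≡ᵇ-false {a} {next a} (next≢id a≤k ∘ sym) = refl
  ... | no a≢b   = contradiction (trans (sym a≡ᵇb) (≡ᵇ-false a≢b)) λ ()

  laplacian≡cycleWeight : ∀ i j → laplacian (suc k) i j ≡ Band.cycleWeight (+ 2) -1ℤ k (toℕ i) (toℕ j)
  laplacian≡cycleWeight i j = begin
    laplacian (suc k) i j
      ≡⟨ cong₂ (λ d c → (if d then degree (suc k) i else + 0) - (if c then + 1 else + 0))
               (isYes≗does (a ≟ b)) (cong₂ _∨_ (isYes≗does (b ≟ next a)) (isYes≗does (a ≟ next b))) ⟩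
    (if a ≡ᵇ b then degree (suc k) i else + 0) - (if adj then + 1 else + 0)
                                                                 ≡⟨ cong (λ d → (if a ≡ᵇ b then d else + 0) - (if adj then + 1 else + 0))
                                                                         (degree-cycle i) ⟩
    (if a ≡ᵇ b then + 2 else + 0) - (if adj then + 1 else + 0)    ≡⟨ diagonal-minus-adjacency (no-loop (toℕ≤pred[n] i)) ⟩
    (if a ≡ᵇ b then + 2 else if adj then -1ℤ else + 0)           ∎
    where
    a b : ℕ
    a = toℕ i
    b = toℕ j
    adj : Bool
    adj = (b ≡ᵇ next a) ∨ (a ≡ᵇ next b)
    diagonal-minus-adjacency : ∀ {d e} → (d ≡ true → e ≡ false) →
                               (if d then + 2 else + 0) - (if e then + 1 else + 0) ≡ (if d then + 2 else if e then -1ℤ else + 0)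
    diagonal-minus-adjacency {true}  {true}  loopless = contradiction (loopless refl) λ ()
    diagonal-minus-adjacency {true}  {false} _        = refl
    diagonal-minus-adjacency {false} {true}  _        = refl
    diagonal-minus-adjacency {false} {false} _        = refl

  p q : ℕ → ℕ
  p = continuantℕ 2 1
  q = continuantℕ 4 1

  per-laplacian : per (laplacian (suc k)) ≡ + 2 * + p (2 ℕ.+ m) + + 2 * + p (1 ℕ.+ m) + + 2 * -1ℤ ℤ.^ (3 ℕ.+ m)
  per-laplacian = begin
    per (laplacian (suc k))                                       ≡⟨ per-cong laplacian≡cycleWeight ⟩
    per (λ (i j : Fin (suc k)) → Band.cycleWeight (+ 2) -1ℤ k (toℕ i) (toℕ j))
                                                                  ≡⟨ Band.per-cycleWeight (+ 2) -1ℤ m ⟩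
    + 2 * C (2 ℕ.+ m) + + 2 * (+ 1 * C (1 ℕ.+ m)) + + 2 * -1ℤ ℤ.^ (3 ℕ.+ m)
                                                                  ≡⟨ cong₂ (λ a b → + 2 * a + + 2 * b + + 2 * -1ℤ ℤ.^ (3 ℕ.+ m))
                                                                           (C≡p (2 ℕ.+ m)) (trans (ℤP.*-identityˡ _) (C≡p (1 ℕ.+ m))) ⟩
    + 2 * + p (2 ℕ.+ m) + + 2 * + p (1 ℕ.+ m) + + 2 * -1ℤ ℤ.^ (3 ℕ.+ m)
                                                                  ∎
    where
    C : ℕ → ℤ
    C = Band.continuant (+ 2) -1ℤ
    C≡p : ∀ n → C n ≡ + p n
    C≡p = continuant≡continuantℕ 2 1 refl

  per-hadamard : per (laplacian (suc k) ∘ₕ laplacian (suc k)) ≡ + (4 ℕ.* q (2 ℕ.+ m) ℕ.+ 2 ℕ.* q (1 ℕ.+ m) ℕ.+ 2)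
  per-hadamard = begin
    per (laplacian (suc k) ∘ₕ laplacian (suc k))                  ≡⟨ per-cong hadamard≡cycleWeight ⟩
    per (λ (i j : Fin (suc k)) → Band.cycleWeight (+ 4) (+ 1) k (toℕ i) (toℕ j))
                                                                  ≡⟨ Band.per-cycleWeight (+ 4) (+ 1) m ⟩
    + 4 * C (2 ℕ.+ m) + + 2 * (+ 1 * C (1 ℕ.+ m)) + + 2 * 1ℤ ℤ.^ (3 ℕ.+ m)
                                                                  ≡⟨ cong₂ (λ a b → + 4 * a + + 2 * b + + 2 * 1ℤ ℤ.^ (3 ℕ.+ m))
                                                                           (C≡q (2 ℕ.+ m)) (trans (ℤP.*-identityˡ _) (C≡q (1 ℕ.+ m))) ⟩
    + 4 * + q (2 ℕ.+ m) + + 2 * + q (1 ℕ.+ m) + + 2 * 1ℤ ℤ.^ (3 ℕ.+ m)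
                                                                  ≡⟨ cong (_+_ (+ 4 * + q (2 ℕ.+ m) + + 2 * + q (1 ℕ.+ m)) ∘ (+ 2 *_))
                                                                          (ℤP.^-zeroˡ (3 ℕ.+ m)) ⟩
    + 4 * + q (2 ℕ.+ m) + + 2 * + q (1 ℕ.+ m) + + 2               ≡⟨ pos-linear 4 (q (2 ℕ.+ m)) 2 (q (1 ℕ.+ m)) 2 ⟨
    + (4 ℕ.* q (2 ℕ.+ m) ℕ.+ 2 ℕ.* q (1 ℕ.+ m) ℕ.+ 2)             ∎
    where
    C : ℕ → ℤ
    C = Band.continuant (+ 4) (+ 1)
    C≡q : ∀ n → C n ≡ + q n
    C≡q = continuant≡continuantℕ 4 1 refl
    hadamard≡cycleWeight : ∀ i j → (laplacian (suc k) ∘ₕ laplacian (suc k)) i j ≡ Band.cycleWeight (+ 4) (+ 1) k (toℕ i) (toℕ j)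
    hadamard≡cycleWeight i j = trans (cong₂ _*_ (laplacian≡cycleWeight i j) (laplacian≡cycleWeight i j))
                                     (cycleWeight-square (+ 2) -1ℤ k (toℕ i) (toℕ j))

theorem5p1 : (n : ℕ) → 3 ≤ n →
    per (laplacian n ∘ₕ laplacian n) ≤ℤ per (laplacian n) * per (laplacian n)
theorem5p1 (suc (suc (suc m))) _ =
  subst₂ _≤ℤ_ (sym per-hadamard) (sym (cong₂ _*_ per-laplacian per-laplacian))
    (cycle-permanent-inequality (continuantℕ-squares 2 1 (2 ℕ.+ m)) (continuantℕ-squares 2 1 (1 ℕ.+ m))
                                (≤-trans (s≤s z≤n) (continuantℕ-≥ 1 (1 ℕ.+ m) (s≤s z≤n))) (continuantℕ-≥ 1 m (s≤s z≤n))
                                (-1^n≡±1 (3 ℕ.+ m)))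
  where open CycleGraph m
theorem5p1 (suc (suc zero)) (s≤s (s≤s ()))
theorem5p1 (suc zero)       (s≤s ())
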